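{- Let $n\ge1$, $\lambda\in Par_{\le2n}$, $\mu\in Par_{\le n}$ with $\mu\subseteq\lambda$, let $Q\in\widetilde{Rec}_{2n}(\lambda/\mu)$ and $k>0$, and let $\mu^{(k-1)}$ be the partition with $D(\mu^{(k-1)})=D(\mu)\cup\{(i,j)\in D(\lambda/\mu):Q(i,j)\ge k\}$. Then: (a) $Q[k]=Q_{\le\ell(\mu^{(k-1)})}[k]$; (b) for every $1\le i\le\ell(\mu^{(k-1)})$, $Q[k]\le Q_{\le i}[k]+(\ell(\mu^{(k-1)})-i)$; (c) $Q[k]\ge2(\ell(\mu^{(k-1)})-n)$ holds if and only if $Q_{\le i}[k]\ge 2(i-n)$ for all $1\le i\le\ell(\mu^{(k-1)})$.
   Context: $Par_{\le m}$: partitions with at most $m$ parts, identified with Young diagrams. For a filling $Q$ of $D(\lambda/\mu)$, $Q[k]$ is the number of entries equal to $k$ and $Q_{\le r}[k]$ the number of entries equal to $k$ in rows $1,\dots,r$. $\widetilde{Rec}_{2n}(\lambda/\mu)$ is the set of fillings $Q$ of $D(\lambda/\mu)$ by positive integers with (R1) entries strictly decreasing along rows left to right; (R2) entries weakly decreasing down columns; (R3) $Q[k]$ even for every $k>0$; (R4) $Q[k]\ge2(\ell(\mu^{(k-1)})-n)$ for every $k>0$, with $\mu^{(k-1)}$ as in the claim; (R5) $Q_{\le r}[k+1]\le Q_{\le r}[k]$ for all $r,k>0$. -}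

module Defs where

open import Data.Nat using (ℕ; zero; suc; _+_; _*_; _∸_; _≤_; _<_; _≤ᵇ_; _≡ᵇ_; _<ᵇ_)
open import Data.Bool using (Bool; true; false; if_then_else_; _∧_)
open import Data.Product using (_×_)
open import Relation.Binary.PropositionalEquality using (_≡_)
open import Data.Nat.Divisibility using (_∣_)

-- Conventions: rows and columns are 0-based internally.  A partition is a
-- function p : ℕ → ℕ, p i = length of row i (row i+1 in the paper's 1-based
-- numbering).  The cell (i , j) lies in row i, column j.

IsPartLe : ℕ → (ℕ → ℕ) → Set
IsPartLe m p = (∀ i → p (suc i) ≤ p i) × (∀ i → m ≤ i → p i ≡ 0)

_⊆ₚ_ : (ℕ → ℕ) → (ℕ → ℕ) → Set
μ ⊆ₚ λ' = ∀ i → μ i ≤ λ' i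

InSkew : (ℕ → ℕ) → (ℕ → ℕ) → ℕ → ℕ → Set
InSkew λ' μ i j = (μ i ≤ j) × (j < λ' i)

countBelow : (ℕ → Bool) → ℕ → ℕ
countBelow p zero = 0
countBelow p (suc m) = countBelow p m + (if p m then 1 else 0)

sumBelow : (ℕ → ℕ) → ℕ → ℕ
sumBelow f zero = 0
sumBelow f (suc m) = sumBelow f m + f m

-- Fillings of D(λ/μ): a function Q : ℕ → ℕ → ℕ whose values on cells of
-- D(λ/μ) are the entries (values elsewhere are irrelevant).

rowCount : (ℕ → ℕ) → (ℕ → ℕ) → (ℕ → ℕ → ℕ) → ℕ → ℕ → ℕ
rowCount λ' μ Q k i = countBelow (λ j → (μ i ≤ᵇ j) ∧ (Q i j ≡ᵇ k)) (λ' i)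

-- Q_{≤ r}[k]: entries equal to k in rows 1,…,r (paper numbering)
QleCount : (ℕ → ℕ) → (ℕ → ℕ) → (ℕ → ℕ → ℕ) → ℕ → ℕ → ℕ
QleCount λ' μ Q r k = sumBelow (rowCount λ' μ Q k) r

-- Q[k] for λ ∈ Par_{≤ m} (all rows of λ lie among the first m rows)
QCount : ℕ → (ℕ → ℕ) → (ℕ → ℕ) → (ℕ → ℕ → ℕ) → ℕ → ℕ
QCount m λ' μ Q k = QleCount λ' μ Q m k

-- μ^{(k-1)}: D(μ^{(k-1)}) = D(μ) ∪ {(i,j) ∈ D(λ/μ) : Q(i,j) ≥ k};
-- row i has μ i cells from D(μ) plus the cells of row i of D(λ/μ) with entry ≥ k.
muPrev : (ℕ → ℕ) → (ℕ → ℕ) → (ℕ → ℕ → ℕ) → ℕ → ℕ → ℕ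
muPrev λ' μ Q k i = μ i + countBelow (λ j → (μ i ≤ᵇ j) ∧ (k ≤ᵇ Q i j)) (λ' i)

-- ℓ(μ^{(k-1)}) = number of nonzero rows; all rows lie among the first m
-- rows when λ ∈ Par_{≤ m}.
lenMuPrev : ℕ → (ℕ → ℕ) → (ℕ → ℕ) → (ℕ → ℕ → ℕ) → ℕ → ℕ
lenMuPrev m λ' μ Q k = countBelow (λ i → 0 <ᵇ muPrev λ' μ Q k i) m

record IsRec (n : ℕ) (λ' μ : ℕ → ℕ) (Q : ℕ → ℕ → ℕ) : Set where
  field
    positive : ∀ i j → InSkew λ' μ i j → 1 ≤ Q i j
    R1 : ∀ i j → InSkew λ' μ i j → InSkew λ' μ i (suc j) → Q i (suc j) < Q i j
    R2 : ∀ i j → InSkew λ' μ i j → InSkew λ' μ (suc i) j → Q (suc i) j ≤ Q i j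
    R3 : ∀ k → 0 < k → 2 ∣ QCount (2 * n) λ' μ Q k
    R4 : ∀ k → 0 < k → 2 * (lenMuPrev (2 * n) λ' μ Q k ∸ n) ≤ QCount (2 * n) λ' μ Q k
    R5 : ∀ r k → 0 < r → 0 < k → QleCount λ' μ Q r (suc k) ≤ QleCount λ' μ Q r k

-- Row entries strictly decrease, so every row of Q contains at most one entry k.
-- The nonzero rows of μ^{(k-1)} form an initial segment: if row i+1 has a cell
-- ≥ k beyond μ, then μ i+1 = 0, its first cell is ≥ k, and by column
-- monotonicity so is the cell above it, unless μ i > 0 already.  Rows ≥ ℓ(μ^{(k-1)})
-- therefore contain no entry ≥ k, which gives (a); (b) follows from (a) since each
-- of the rows i+1, …, ℓ contributes at most one k.  In (c), (b) turns the bound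
-- 2(ℓ - n) ≤ Q[k] into 2(i - n) ≤ Q_{≤ i}[k], and the converse is the case i = ℓ of (a).
module Submission where

open import Defs
open import Data.Nat
open import Data.Nat.Properties
open import Data.Bool using (Bool; true; false; T; _∧_)
open import Data.Bool.Properties using (T-∧)
open import Data.Empty using (⊥-elim)
open import Data.Product using (_×_; _,_; proj₁; proj₂; ∃-syntax)
open import Data.Sum using (inj₁; inj₂)
open import Function.Bundles using (_⇔_; mk⇔; Equivalence)
open import Relation.Binary.PropositionalEquality
open import Relation.Binary.Definitions using (tri<; tri≈; tri>)
open import Relation.Nullary using (¬_; yes; no)

private
  variable
    p q : ℕ → Bool
    i j m m′ : ℕ

countBelow≤ : ∀ p m → countBelow p m ≤ m
countBelow≤ p zero = z≤n
countBelow≤ p (suc m) with p m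
... | true  = subst (_≤ suc m) (+-comm 1 _) (s≤s (countBelow≤ p m))
... | false = subst (_≤ suc m) (sym (+-identityʳ _)) (m≤n⇒m≤1+n (countBelow≤ p m))

countBelow-mono : (∀ j → T (p j) → T (q j)) → ∀ m → countBelow p m ≤ countBelow q m
countBelow-mono {p} {q} p⇒q zero = z≤n
countBelow-mono {p} {q} p⇒q (suc m) with p m in pm | q m in qm
... | true  | true  = +-monoˡ-≤ 1 (countBelow-mono p⇒q m)
... | false | true  = +-mono-≤ (countBelow-mono p⇒q m) z≤n
... | false | false = +-monoˡ-≤ 0 (countBelow-mono p⇒q m)
... | true  | false = ⊥-elim (subst T qm (p⇒q m (subst T (sym pm) _)))

countBelow-monoʳ : m ≤′ m′ → countBelow p m ≤ countBelow p m′
countBelow-monoʳ ≤′-refl        = ≤-refl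
countBelow-monoʳ (≤′-step m≤m′) = ≤-trans (countBelow-monoʳ m≤m′) (m≤m+n _ _)

countBelow-none : (∀ j → j < m → ¬ T (p j)) → countBelow p m ≡ 0
countBelow-none {zero}      none = refl
countBelow-none {suc m} {p} none with p m in pm
... | true  = ⊥-elim (none m ≤-refl (subst T (sym pm) _))
... | false = trans (+-identityʳ _) (countBelow-none λ j j<m → none j (m<n⇒m<1+n j<m))

countBelow-all : (∀ j → j < m → T (p j)) → countBelow p m ≡ m
countBelow-all {zero}      all = refl
countBelow-all {suc m} {p} all with p m | all m ≤-refl
... | true | _ = trans (cong (_+ 1) (countBelow-all λ j j<m → all j (m<n⇒m<1+n j<m))) (+-comm m 1)

countBelow-≤1 : (∀ a b → a < m → b < m → T (p a) → T (p b) → a ≡ b) → countBelow p m ≤ 1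
countBelow-≤1 {zero}      unique = z≤n
countBelow-≤1 {suc m} {p} unique with p m in pm
... | false = subst (_≤ 1) (sym (+-identityʳ _))
                (countBelow-≤1 λ a b a<m b<m → unique a b (m<n⇒m<1+n a<m) (m<n⇒m<1+n b<m))
... | true  = ≤-reflexive (cong (_+ 1) (countBelow-none λ j j<m pj →
                <-irrefl (unique j m (m<n⇒m<1+n j<m) ≤-refl pj (subst T (sym pm) _)) j<m))

countBelow-witness : ∀ m → 0 < countBelow p m → ∃[ j ] j < m × T (p j)
countBelow-witness {p} (suc m) pos with p m in pm
... | true  = m , ≤-refl , subst T (sym pm) _
... | false with countBelow-witness m (subst (0 <_) (+-identityʳ _) pos)
...   | j , j<m , pj = j , m<n⇒m<1+n j<m , pj

countBelow-pos : j < m → T (p j) → 0 < countBelow p m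
countBelow-pos {j} {suc m} {p} j<1+m pj with p m in pm
... | true  = subst (0 <_) (+-comm 1 _) z<s
... | false with m≤n⇒m<n∨m≡n (≤-pred j<1+m)
...   | inj₁ j<m  = subst (0 <_) (sym (+-identityʳ _)) (countBelow-pos j<m pj)
...   | inj₂ refl = ⊥-elim (subst T pm pj)

DownClosed : (ℕ → Bool) → Set
DownClosed p = ∀ i → T (p (suc i)) → T (p i)

downClosed-≤ : DownClosed p → j ≤′ i → T (p i) → T (p j)
downClosed-≤ closed ≤′-refl       pi = pi
downClosed-≤ closed (≤′-step j≤i) pi = downClosed-≤ closed j≤i (closed _ pi)

-- For a down-closed predicate, countBelow p m is the length of the initial segment where p holds.
downClosed-<count : DownClosed p → i < m → T (p i) → i < countBelow p m
downClosed-<count {p} {i} {m} closed i<m pi = begin-strict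
  i                     <⟨ n<1+n i ⟩
  suc i                 ≡⟨ sym (countBelow-all λ j j<1+i → downClosed-≤ closed (≤⇒≤′ (≤-pred j<1+i)) pi) ⟩
  countBelow p (suc i)  ≤⟨ countBelow-monoʳ (≤⇒≤′ i<m) ⟩
  countBelow p m        ∎
  where open ≤-Reasoning

sumBelow-vanishing : ∀ (f : ℕ → ℕ) L d → (∀ j → L ≤ j → f j ≡ 0) → sumBelow f (d + L) ≡ sumBelow f L
sumBelow-vanishing f L zero    vanish = refl
sumBelow-vanishing f L (suc d) vanish =
  trans (cong₂ _+_ (sumBelow-vanishing f L d vanish) (vanish (d + L) (m≤n+m L d))) (+-identityʳ _)

sumBelow-≤1 : ∀ (f : ℕ → ℕ) i d → (∀ j → f j ≤ 1) → sumBelow f (d + i) ≤ sumBelow f i + d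
sumBelow-≤1 f i zero    f≤1 = ≤-reflexive (sym (+-identityʳ _))
sumBelow-≤1 f i (suc d) f≤1 = begin
  sumBelow f (d + i) + f (d + i)  ≤⟨ +-mono-≤ (sumBelow-≤1 f i d f≤1) (f≤1 (d + i)) ⟩
  sumBelow f i + d + 1            ≡⟨ +-assoc _ d 1 ⟩
  sumBelow f i + (d + 1)          ≡⟨ cong (sumBelow f i +_) (+-comm d 1) ⟩
  sumBelow f i + suc d            ∎
  where open ≤-Reasoning

∸-split : ∀ {n i L} → n ≤ i → i ≤ L → L ∸ n ≡ (i ∸ n) + (L ∸ i)
∸-split {n} {i} {L} n≤i i≤L = begin
  L ∸ n              ≡⟨ cong (_∸ n) (sym (m∸n+n≡m i≤L)) ⟩
  (L ∸ i) + i ∸ n    ≡⟨ +-∸-assoc (L ∸ i) n≤i ⟩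
  (L ∸ i) + (i ∸ n)  ≡⟨ +-comm (L ∸ i) (i ∸ n) ⟩
  (i ∸ n) + (L ∸ i)  ∎
  where open ≡-Reasoning

twice-∸-transfer : ∀ n {i L A C} → i ≤ L → 2 * (L ∸ n) ≤ C → C ≤ A + (L ∸ i) → 2 * (i ∸ n) ≤ A
twice-∸-transfer n {i} {L} {A} {C} i≤L 2[L∸n]≤C C≤A+[L∸i] with n ≤? i
... | no n≰i = subst (λ x → 2 * x ≤ A) (sym (m≤n⇒m∸n≡0 (<⇒≤ (≰⇒> n≰i)))) z≤n
... | yes n≤i = +-cancelʳ-≤ (L ∸ i) (2 * (i ∸ n)) A (begin
  2 * (i ∸ n) + (L ∸ i)          ≤⟨ +-monoʳ-≤ (2 * (i ∸ n)) (m≤n*m (L ∸ i) 2) ⟩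
  2 * (i ∸ n) + 2 * (L ∸ i)      ≡⟨ sym (*-distribˡ-+ 2 (i ∸ n) (L ∸ i)) ⟩
  2 * ((i ∸ n) + (L ∸ i))        ≡⟨ cong (2 *_) (sym (∸-split n≤i i≤L)) ⟩
  2 * (L ∸ n)                    ≤⟨ 2[L∸n]≤C ⟩
  C                              ≤⟨ C≤A+[L∸i] ⟩
  A + (L ∸ i)                    ∎)
  where open ≤-Reasoning

twice-∸-at-top : ∀ n L (g : ℕ → ℕ) → (∀ i → 1 ≤ i → i ≤ L → 2 * (i ∸ n) ≤ g i) → 2 * (L ∸ n) ≤ g L
twice-∸-at-top n zero    g bound rewrite 0∸n≡0 n = z≤n
twice-∸-at-top n (suc L) g bound = bound (suc L) (s≤s z≤n) ≤-refl

module RecFilling {n : ℕ} {λ' μ : ℕ → ℕ} (λ-part : IsPartLe (2 * n) λ') (μ-part : IsPartLe n μ)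
         {Q : ℕ → ℕ → ℕ} (rec : IsRec n λ' μ Q) (k : ℕ) where
  open IsRec rec

  row-strictlyDecreasing : ∀ {i a b} → μ i ≤ a → a < b → b < λ' i → Q i b < Q i a
  row-strictlyDecreasing {i} {a} μ≤a a<b = go (≤⇒≤′ a<b)
    where
    go : ∀ {b} → suc a ≤′ b → b < λ' i → Q i b < Q i a
    go ≤′-refl b<λ = R1 i a (μ≤a , <-trans (n<1+n a) b<λ) (m≤n⇒m≤1+n μ≤a , b<λ)
    go {suc b} (≤′-step a<b) b<λ =
      <-trans (R1 i b (μ≤b , b<λ′) (m≤n⇒m≤1+n μ≤b , b<λ)) (go a<b b<λ′)
      where
      μ≤b : μ i ≤ b
      μ≤b = ≤-trans μ≤a (<⇒≤ (≤′⇒≤ a<b))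
      b<λ′ : b < λ' i
      b<λ′ = <-trans (n<1+n b) b<λ

  row-decreasing : ∀ {i a b} → μ i ≤ a → a ≤ b → b < λ' i → Q i b ≤ Q i a
  row-decreasing μ≤a a≤b b<λ with m≤n⇒m<n∨m≡n a≤b
  ... | inj₁ a<b  = <⇒≤ (row-strictlyDecreasing μ≤a a<b b<λ)
  ... | inj₂ refl = ≤-refl

  cellEq cellGe : ℕ → ℕ → Bool
  cellEq i j = (μ i ≤ᵇ j) ∧ (Q i j ≡ᵇ k)
  cellGe i j = (μ i ≤ᵇ j) ∧ (k ≤ᵇ Q i j)

  cellsGe : ℕ → ℕ
  cellsGe i = countBelow (cellGe i) (λ' i)

  rowCount≤1 : ∀ i → rowCount λ' μ Q k i ≤ 1
  rowCount≤1 i = countBelow-≤1 unique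
    where
    unique : ∀ a b → a < λ' i → b < λ' i → T (cellEq i a) → T (cellEq i b) → a ≡ b
    unique a b a<λ b<λ ca cb with Equivalence.to T-∧ ca | Equivalence.to T-∧ cb
    ... | μ≤a , Qa≡k | μ≤b , Qb≡k with <-cmp a b
    ...   | tri≈ _ a≡b _ = a≡b
    ...   | tri< a<b _ _ = ⊥-elim (<-irrefl (trans (≡ᵇ⇒≡ _ _ Qb≡k) (sym (≡ᵇ⇒≡ _ _ Qa≡k)))
                                    (row-strictlyDecreasing (≤ᵇ⇒≤ _ _ μ≤a) a<b b<λ))
    ...   | tri> _ _ b<a = ⊥-elim (<-irrefl (trans (≡ᵇ⇒≡ _ _ Qa≡k) (sym (≡ᵇ⇒≡ _ _ Qb≡k)))
                                    (row-strictlyDecreasing (≤ᵇ⇒≤ _ _ μ≤b) b<a a<λ))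

  rowCount≤muPrev : ∀ i → rowCount λ' μ Q k i ≤ muPrev λ' μ Q k i
  rowCount≤muPrev i = ≤-trans (countBelow-mono eq⇒ge (λ' i)) (m≤n+m (cellsGe i) (μ i))
    where
    eq⇒ge : ∀ j → T (cellEq i j) → T (cellGe i j)
    eq⇒ge j c with Equivalence.to (T-∧ {μ i ≤ᵇ j}) c
    ... | μ≤j , Q≡k = Equivalence.from (T-∧ {μ i ≤ᵇ j}) (μ≤j , ≤⇒≤ᵇ (≤-reflexive (sym (≡ᵇ⇒≡ (Q i j) k Q≡k))))

  firstCellGe : ∀ i → μ i ≡ 0 → 0 < muPrev λ' μ Q k i → k ≤ Q i 0
  firstCellGe i μi≡0 pos with countBelow-witness (λ' i) (subst (λ x → 0 < x + cellsGe i) μi≡0 pos)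
  ... | j , j<λ , c = ≤-trans (≤ᵇ⇒≤ _ _ (proj₂ (Equivalence.to (T-∧ {μ i ≤ᵇ j}) c)))
                              (row-decreasing (≤-reflexive μi≡0) z≤n j<λ)

  muPrev-downClosed : DownClosed (λ i → 0 <ᵇ muPrev λ' μ Q k i)
  muPrev-downClosed i pos₊ = <⇒<ᵇ (rowBelow (<ᵇ⇒< 0 _ pos₊))
    where
    rowBelow : 0 < muPrev λ' μ Q k (suc i) → 0 < muPrev λ' μ Q k i
    rowBelow pos with 0 <? μ i
    ... | yes μi>0 = ≤-trans μi>0 (m≤m+n (μ i) (cellsGe i))
    ... | no μi≯0 = ≤-trans (countBelow-pos {p = cellGe i} 0<λi
                              (Equivalence.from (T-∧ {μ i ≤ᵇ 0}) (≤⇒≤ᵇ (≤-reflexive μi≡0) , ≤⇒≤ᵇ k≤Qi0)))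
                            (m≤n+m (cellsGe i) (μ i))
      where
      μi≡0 : μ i ≡ 0
      μi≡0 = n≤0⇒n≡0 (≮⇒≥ μi≯0)
      μ₊≡0 : μ (suc i) ≡ 0
      μ₊≡0 = n≤0⇒n≡0 (subst (μ (suc i) ≤_) μi≡0 (proj₁ μ-part i))
      0<λ₊ : 0 < λ' (suc i)
      0<λ₊ with countBelow-witness (λ' (suc i)) (subst (λ x → 0 < x + cellsGe (suc i)) μ₊≡0 pos)
      ... | j , j<λ , _ = ≤-<-trans z≤n j<λ
      0<λi : 0 < λ' i
      0<λi = ≤-trans 0<λ₊ (proj₁ λ-part i)
      k≤Qi0 : k ≤ Q i 0
      k≤Qi0 = ≤-trans (firstCellGe (suc i) μ₊≡0 pos)
                      (R2 i 0 (≤-reflexive μi≡0 , 0<λi) (≤-reflexive μ₊≡0 , 0<λ₊))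

  private
    L : ℕ
    L = lenMuPrev (2 * n) λ' μ Q k

  rowCount-beyondLength : ∀ j → L ≤ j → rowCount λ' μ Q k j ≡ 0
  rowCount-beyondLength j L≤j with j <? 2 * n
  ... | yes j<2n = n≤0⇒n≡0 (≤-trans (rowCount≤muPrev j) (≮⇒≥ λ pos →
                     <⇒≱ (downClosed-<count muPrev-downClosed j<2n (<⇒<ᵇ pos)) L≤j))
  ... | no j≮2n = cong (countBelow (cellEq j)) (proj₂ λ-part j (≮⇒≥ j≮2n))

  QCount≡QleCount-length : QCount (2 * n) λ' μ Q k ≡ QleCount λ' μ Q L k
  QCount≡QleCount-length = begin
    sumBelow rc (2 * n)            ≡⟨ cong (sumBelow rc) (sym (m∸n+n≡m (countBelow≤ _ (2 * n)))) ⟩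
    sumBelow rc ((2 * n ∸ L) + L)  ≡⟨ sumBelow-vanishing rc L (2 * n ∸ L) rowCount-beyondLength ⟩
    sumBelow rc L                  ∎
    where
    open ≡-Reasoning
    rc : ℕ → ℕ
    rc = rowCount λ' μ Q k

  QCount≤QleCount+rest : ∀ i → i ≤ L → QCount (2 * n) λ' μ Q k ≤ QleCount λ' μ Q i k + (L ∸ i)
  QCount≤QleCount+rest i i≤L = begin
    QCount (2 * n) λ' μ Q k                        ≡⟨ QCount≡QleCount-length ⟩
    sumBelow (rowCount λ' μ Q k) L                 ≡⟨ cong (sumBelow (rowCount λ' μ Q k)) (sym (m∸n+n≡m i≤L)) ⟩
    sumBelow (rowCount λ' μ Q k) ((L ∸ i) + i)     ≤⟨ sumBelow-≤1 (rowCount λ' μ Q k) i (L ∸ i) rowCount≤1 ⟩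
    QleCount λ' μ Q i k + (L ∸ i)                  ∎
    where open ≤-Reasoning

mainTheorem3 : (n : ℕ) → 1 ≤ n → (λ' μ : ℕ → ℕ) → IsPartLe (2 * n) λ' → IsPartLe n μ → μ ⊆ₚ λ'
    → (Q : ℕ → ℕ → ℕ) → IsRec n λ' μ Q → (k : ℕ) → 0 < k
    → (QCount (2 * n) λ' μ Q k ≡ QleCount λ' μ Q (lenMuPrev (2 * n) λ' μ Q k) k)
      × (∀ i → 1 ≤ i → i ≤ lenMuPrev (2 * n) λ' μ Q k
           → QCount (2 * n) λ' μ Q k ≤ QleCount λ' μ Q i k + (lenMuPrev (2 * n) λ' μ Q k ∸ i))
      × ((2 * (lenMuPrev (2 * n) λ' μ Q k ∸ n) ≤ QCount (2 * n) λ' μ Q k)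
         ⇔ (∀ i → 1 ≤ i → i ≤ lenMuPrev (2 * n) λ' μ Q k → 2 * (i ∸ n) ≤ QleCount λ' μ Q i k))
mainTheorem3 n _ λ' μ λ-part μ-part _ Q rec k _ =
  QCount≡QleCount-length ,
  (λ i _ i≤L → QCount≤QleCount+rest i i≤L) ,
  mk⇔ (λ bound i _ i≤L → twice-∸-transfer n i≤L bound (QCount≤QleCount+rest i i≤L))
      (λ bounds → subst (2 * (L ∸ n) ≤_) (sym QCount≡QleCount-length)
                        (twice-∸-at-top n L (λ i → QleCount λ' μ Q i k) bounds))
  where
  open RecFilling λ-part μ-part rec k
  L : ℕ
  L = lenMuPrev (2 * n) λ' μ Q k
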